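{- Let $q\in\mathbb{C}$ with $q\neq1$ be such that $[n]_q\neq 0$ for all $n\geq 1$, let $u,\alpha\in\mathbb{C}$, let $(a_n^{(\alpha)})_{n\ge0}$ be complex numbers with $a_0^{(\alpha)}\neq0$, $(\mathcal{A}_q(t))^{\alpha}=\sum_{n\ge0}a_n^{(\alpha)}\frac{t^n}{[n]_q!}$, and define $\mathrm{P}_{n,q}^{(\alpha)}(x,y;u)$ by $(\mathcal{A}_q(t))^{\alpha}\mathrm{e}_q(tx)\mathrm{e}_q(ty,u)=\sum_{n\ge0}\mathrm{P}_{n,q}^{(\alpha)}(x,y;u)\frac{t^n}{[n]_q!}$. Then for all $n\ge1$, $$D_{q,x}\mathrm{P}_{n,q}^{(\alpha)}(x,y;u)=[n]_q\mathrm{P}_{n-1,q}^{(\alpha)}(x,y;u),\qquad D_{q,y}\mathrm{P}_{n,q}^{(\alpha)}(x,y;u)=[n]_q\mathrm{P}_{n-1,q}^{(\alpha)}(x,uy;u).$$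
   Context: $[n]_q=\frac{1-q^n}{1-q}$, $[n]_q!=[1]_q\cdots[n]_q$ ($[0]_q!=1$). $\mathrm{e}_q(z,u)=\sum_{n\ge0}u^{\binom{n}{2}}\frac{z^n}{[n]_q!}$ (convention $0^0=1$), $\mathrm{e}_q(z)=\mathrm{e}_q(z,1)$. The $q$-derivative is $D_qf(x)=\frac{f(x)-f(qx)}{(1-q)x}$; $D_{q,x}$, $D_{q,y}$ denote the $q$-derivative with respect to $x$, resp. $y$. -}

module Defs where

open import Level using (_⊔_) renaming (suc to lsuc)
open import Data.Nat using (ℕ; zero; suc; _∸_)
open import Data.Nat.Combinatorics using (_C_)
open import Algebra.Bundles using (CommutativeRing)
open import Relation.Nullary using (¬_)

-- The value of
-- 0 ⁻¹ is unspecified (it is never used in the statement).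
record Field c ℓ : Set (lsuc (c ⊔ ℓ)) where
  field
    commutativeRing : CommutativeRing c ℓ
  open CommutativeRing commutativeRing public
  infix 8 _⁻¹
  field
    _⁻¹      : Carrier → Carrier
    ⁻¹-cong  : ∀ {x y} → x ≈ y → x ⁻¹ ≈ y ⁻¹
    inverseʳ : ∀ x → ¬ (x ≈ 0#) → x * x ⁻¹ ≈ 1#
    0≉1      : ¬ (0# ≈ 1#)

module FieldDefs {c ℓ} (F : Field c ℓ) where
  open Field F public

  pow : Carrier → ℕ → Carrier
  pow x zero    = 1#
  pow x (suc n) = x * pow x n

  sumTo : ℕ → (ℕ → Carrier) → Carrier
  sumTo zero    f = f 0
  sumTo (suc n) f = sumTo n f + f (suc n)

  qint : Carrier → ℕ → Carrier
  qint q n = (1# - pow q n) * (1# - q) ⁻¹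

  qfact : Carrier → ℕ → Carrier
  qfact q zero    = 1#
  qfact q (suc n) = qfact q n * qint q (suc n)

  -- formal power series in t, given by their coefficient sequences
  -- (coefficient of t^n)
  Series : Set c
  Series = ℕ → Carrier

  _⊛_ : Series → Series → Series
  (f ⊛ g) n = sumTo n (λ k → f k * g (n ∸ k))

  qexpSeries : Carrier → (ℕ → Carrier) → Series
  qexpSeries q b n = b n * (qfact q n) ⁻¹

  -- e_q(tz, u) = Σ_n u^{binom(n,2)} (tz)^n / [n]_q!
  eqSeries : Carrier → Carrier → Carrier → Series
  eqSeries q z u = qexpSeries q (λ n → pow u (n C 2) * pow z n)

  Dq : Carrier → (Carrier → Carrier) → Carrier → Carrier
  Dq q f x = (f x - f (q * x)) * ((1# - q) * x) ⁻¹

{-# OPTIONS --safe #-}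
module Submission where

-- Since 1 − q^(n+1) = [n+1]_q (1 − q), the coefficients of e_q(ty,u) satisfy the
-- q-difference equation  e_q(ty,u) − e_q(qty,u) = (1 − q) y t e_q(uty,u).
-- An identity of the shape g − g′ = s t h survives multiplying both sides by any
-- series, so the generating function of the P_n inherits it, in x (where u = 1)
-- and in y.  Comparing coefficients of t^n and multiplying by [n]_q! = [n−1]_q! [n]_q
-- gives P_n(x) − P_n(qx) = (1 − q) x [n]_q P_{n−1}(x), i.e. the claim.

open import Defs
open import Data.Nat as Nat using (ℕ; zero; suc; _≤_; _∸_; s≤s; z≤n)
open import Data.Nat.Properties using (n∸n≡0; +-∸-assoc; m≤n⇒m≤1+n; ≤-refl)
open import Data.Nat.Combinatorics using (_C_; nC1≡n; nCk+nC[k+1]≡[n+1]C[k+1])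
open import Data.Product using (_×_; _,_)
open import Relation.Nullary using (¬_)
open import Relation.Binary.PropositionalEquality as ≡ using (_≡_)
import Algebra.Properties.AbelianGroup as AbelianGroupProperties
import Algebra.Properties.CommutativeSemigroup as CommutativeSemigroupProperties
import Algebra.Properties.CommutativeSemiring.Exp as CommutativeSemiringExp
import Algebra.Properties.Group as GroupProperties
import Algebra.Properties.Semiring.Exp as SemiringExp
import Algebra.Solver.Ring.NaturalCoefficients.Default as SemiringSolver
import Relation.Binary.Reasoning.Setoid as SetoidReasoning

module FormalSeries {c ℓ} (F : Field c ℓ) where
  open FieldDefs F
  open SetoidReasoning setoid
  open SemiringExp semiring using (_^_; ^-congˡ; ^-homo-*)
  open CommutativeSemiringExp commutativeSemiring using (^-distrib-*)
  open SemiringSolver commutativeSemiring using (solve; _:=_; _:+_; _:*_)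
  open AbelianGroupProperties +-abelianGroup using (xyx⁻¹≈y)
  open GroupProperties +-group using (x∙y⁻¹≈ε⇒x≈y; //-rightDividesˡ)
  module +-CS = CommutativeSemigroupProperties +-commutativeSemigroup
  module *-CS = CommutativeSemigroupProperties *-commutativeSemigroup

  x*y*y⁻¹≈x : ∀ {x y} → ¬ (y ≈ 0#) → (x * y) * y ⁻¹ ≈ x
  x*y*y⁻¹≈x {x} {y} y≉0 = begin
    (x * y) * y ⁻¹  ≈⟨ *-assoc x y (y ⁻¹) ⟩
    x * (y * y ⁻¹)  ≈⟨ *-congˡ (inverseʳ y y≉0) ⟩
    x * 1#          ≈⟨ *-identityʳ x ⟩
    x               ∎

  x*y⁻¹*y≈x : ∀ {x y} → ¬ (y ≈ 0#) → (x * y ⁻¹) * y ≈ x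
  x*y⁻¹*y≈x {x} {y} y≉0 = trans (*-CS.xy∙z≈xz∙y x (y ⁻¹) y) (x*y*y⁻¹≈x y≉0)

  x*y*x⁻¹≈y : ∀ {x y} → ¬ (x ≈ 0#) → (x * y) * x ⁻¹ ≈ y
  x*y*x⁻¹≈y {x} {y} x≉0 = trans (*-congʳ (*-comm x y)) (x*y*y⁻¹≈x x≉0)

  x*y≉0 : ∀ {x y} → ¬ (x ≈ 0#) → ¬ (y ≈ 0#) → ¬ (x * y ≈ 0#)
  x*y≉0 {x} {y} x≉0 y≉0 xy≈0 = y≉0 (begin
    y               ≈⟨ x*y*x⁻¹≈y x≉0 ⟨
    (x * y) * x ⁻¹  ≈⟨ *-congʳ xy≈0 ⟩
    0# * x ⁻¹       ≈⟨ zeroˡ (x ⁻¹) ⟩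
    0#              ∎)

  inverseʳ-unique : ∀ {x y} → x * y ≈ 1# → y ≈ x ⁻¹
  inverseʳ-unique {x} {y} xy≈1 = begin
    y               ≈⟨ x*y*x⁻¹≈y x≉0 ⟨
    (x * y) * x ⁻¹  ≈⟨ *-congʳ xy≈1 ⟩
    1# * x ⁻¹       ≈⟨ *-identityˡ (x ⁻¹) ⟩
    x ⁻¹            ∎
    where
    x≉0 : ¬ (x ≈ 0#)
    x≉0 x≈0 = 0≉1 (trans (sym (zeroˡ y)) (trans (*-congʳ (sym x≈0)) xy≈1))

  1-x≉0 : ∀ {x} → ¬ (x ≈ 1#) → ¬ (1# - x ≈ 0#)
  1-x≉0 {x} x≉1 1-x≈0 = x≉1 (sym (x∙y⁻¹≈ε⇒x≈y 1# x 1-x≈0))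

  pow≡^ : ∀ x n → pow x n ≡ x ^ n
  pow≡^ x zero    = ≡.refl
  pow≡^ x (suc n) = ≡.cong (x *_) (pow≡^ x n)

  pow-congˡ : ∀ {x y} n → x ≈ y → pow x n ≈ pow y n
  pow-congˡ {x} {y} n x≈y = begin
    pow x n  ≡⟨ pow≡^ x n ⟩
    x ^ n    ≈⟨ ^-congˡ n x≈y ⟩
    y ^ n    ≡⟨ pow≡^ y n ⟨
    pow y n  ∎

  pow-homo-+ : ∀ x m n → pow x (m Nat.+ n) ≈ pow x m * pow x n
  pow-homo-+ x m n = begin
    pow x (m Nat.+ n)  ≡⟨ pow≡^ x (m Nat.+ n) ⟩
    x ^ (m Nat.+ n)    ≈⟨ ^-homo-* x m n ⟩
    x ^ m * x ^ n      ≡⟨ ≡.cong₂ _*_ (pow≡^ x m) (pow≡^ x n) ⟨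
    pow x m * pow x n  ∎

  pow-distrib-* : ∀ x y n → pow (x * y) n ≈ pow x n * pow y n
  pow-distrib-* x y n = begin
    pow (x * y) n      ≡⟨ pow≡^ (x * y) n ⟩
    (x * y) ^ n        ≈⟨ ^-distrib-* x y n ⟩
    x ^ n * y ^ n      ≡⟨ ≡.cong₂ _*_ (pow≡^ x n) (pow≡^ y n) ⟨
    pow x n * pow y n  ∎

  pow-[1+m]C2 : ∀ x m → pow x (suc m C 2) ≈ pow x m * pow x (m C 2)
  pow-[1+m]C2 x m = begin
    pow x (suc m C 2)        ≡⟨ ≡.cong (pow x) [1+m]C2≡m+mC2 ⟩
    pow x (m Nat.+ m C 2)    ≈⟨ pow-homo-+ x m (m C 2) ⟩
    pow x m * pow x (m C 2)  ∎
    where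
    [1+m]C2≡m+mC2 : suc m C 2 ≡ m Nat.+ m C 2
    [1+m]C2≡m+mC2 = ≡.trans (≡.sym (nCk+nC[k+1]≡[n+1]C[k+1] m 1)) (≡.cong (Nat._+ m C 2) (nC1≡n m))

  sumTo-linear : ∀ n {f g h} s → (∀ k → k ≤ n → f k ≈ g k + s * h k) →
                 sumTo n f ≈ sumTo n g + s * sumTo n h
  sumTo-linear zero    s f≈ = f≈ 0 z≤n
  sumTo-linear (suc n) {f} {g} {h} s f≈ = begin
    sumTo n f + f (suc n)
      ≈⟨ +-cong (sumTo-linear n s (λ k k≤n → f≈ k (m≤n⇒m≤1+n k≤n))) (f≈ (suc n) ≤-refl) ⟩
    (sumTo n g + s * sumTo n h) + (g (suc n) + s * h (suc n))
      ≈⟨ solve 5 (λ G s H g h → (G :+ s :* H) :+ (g :+ s :* h) := (G :+ g) :+ s :* (H :+ h))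
               refl (sumTo n g) s (sumTo n h) (g (suc n)) (h (suc n)) ⟩
    (sumTo n g + g (suc n)) + s * (sumTo n h + h (suc n))
      ∎

  sumTo-suc : ∀ n f → sumTo (suc n) f ≈ f 0 + sumTo n (λ k → f (suc k))
  sumTo-suc zero    f = refl
  sumTo-suc (suc n) f = trans (+-congʳ (sumTo-suc n f)) (+-assoc _ _ _)

  -- g ⊖ g′ ≋ s ·t· h  encodes the identity  g(t) − g′(t) = s t h(t)  of power series.
  infix 4 _⊖_≋_·t·_
  record _⊖_≋_·t·_ (g g′ : Series) (s : Carrier) (h : Series) : Set ℓ where
    field
      constant : g 0 ≈ g′ 0
      step     : ∀ n → g (suc n) ≈ g′ (suc n) + s * h n
  open _⊖_≋_·t·_ public

  ·t·-cong : ∀ {g g′ s h h′} → (∀ n → h n ≈ h′ n) → g ⊖ g′ ≋ s ·t· h → g ⊖ g′ ≋ s ·t· h′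
  ·t·-cong h≈h′ g≋ = record
    { constant = constant g≋
    ; step     = λ n → trans (step g≋ n) (+-congˡ (*-congˡ (h≈h′ n)))
    }

  ⊛-⊖ʳ : ∀ f {g g′ s h} → g ⊖ g′ ≋ s ·t· h → (f ⊛ g) ⊖ (f ⊛ g′) ≋ s ·t· (f ⊛ h)
  ⊛-⊖ʳ f {g} {g′} {s} {h} g≋ = record { constant = *-congˡ (constant g≋) ; step = step′ }
    where
    step′ : ∀ n → (f ⊛ g) (suc n) ≈ (f ⊛ g′) (suc n) + s * (f ⊛ h) n
    step′ n = begin
      sumTo n (λ k → f k * g (suc n ∸ k)) + f (suc n) * g (n ∸ n)
        ≈⟨ +-cong (sumTo-linear n s term) (*-congˡ last) ⟩
      (sumTo n (λ k → f k * g′ (suc n ∸ k)) + s * (f ⊛ h) n) + f (suc n) * g′ (n ∸ n)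
        ≈⟨ +-CS.xy∙z≈xz∙y _ _ _ ⟩
      (f ⊛ g′) (suc n) + s * (f ⊛ h) n
        ∎
      where
      last : g (n ∸ n) ≈ g′ (n ∸ n)
      last rewrite n∸n≡0 n = constant g≋

      term : ∀ k → k ≤ n → f k * g (suc n ∸ k) ≈ f k * g′ (suc n ∸ k) + s * (f k * h (n ∸ k))
      term k k≤n rewrite +-∸-assoc 1 k≤n = begin
        f k * g (suc (n ∸ k))                           ≈⟨ *-congˡ (step g≋ (n ∸ k)) ⟩
        f k * (g′ (suc (n ∸ k)) + s * h (n ∸ k))        ≈⟨ distribˡ _ _ _ ⟩
        f k * g′ (suc (n ∸ k)) + f k * (s * h (n ∸ k))  ≈⟨ +-congˡ (*-CS.x∙yz≈y∙xz _ _ _) ⟩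
        f k * g′ (suc (n ∸ k)) + s * (f k * h (n ∸ k))  ∎

  ⊛-⊖ˡ : ∀ f {g g′ s h} → g ⊖ g′ ≋ s ·t· h → (g ⊛ f) ⊖ (g′ ⊛ f) ≋ s ·t· (h ⊛ f)
  ⊛-⊖ˡ f {g} {g′} {s} {h} g≋ = record { constant = *-congʳ (constant g≋) ; step = step′ }
    where
    step′ : ∀ n → (g ⊛ f) (suc n) ≈ (g′ ⊛ f) (suc n) + s * (h ⊛ f) n
    step′ n = begin
      (g ⊛ f) (suc n)
        ≈⟨ sumTo-suc n _ ⟩
      g 0 * f (suc n) + sumTo n (λ k → g (suc k) * f (n ∸ k))
        ≈⟨ +-cong (*-congʳ (constant g≋)) (sumTo-linear n s term) ⟩
      g′ 0 * f (suc n) + (sumTo n (λ k → g′ (suc k) * f (n ∸ k)) + s * (h ⊛ f) n)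
        ≈⟨ +-assoc _ _ _ ⟨
      (g′ 0 * f (suc n) + sumTo n (λ k → g′ (suc k) * f (n ∸ k))) + s * (h ⊛ f) n
        ≈⟨ +-congʳ (sumTo-suc n _) ⟨
      (g′ ⊛ f) (suc n) + s * (h ⊛ f) n
        ∎
      where
      term : ∀ k → k ≤ n → g (suc k) * f (n ∸ k) ≈ g′ (suc k) * f (n ∸ k) + s * (h k * f (n ∸ k))
      term k _ = begin
        g (suc k) * f (n ∸ k)                           ≈⟨ *-congʳ (step g≋ k) ⟩
        (g′ (suc k) + s * h k) * f (n ∸ k)              ≈⟨ distribʳ _ _ _ ⟩
        g′ (suc k) * f (n ∸ k) + (s * h k) * f (n ∸ k)  ≈⟨ +-congˡ (*-assoc _ _ _) ⟩
        g′ (suc k) * f (n ∸ k) + s * (h k * f (n ∸ k))  ∎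

  eqSeries-cong : ∀ q u {z z′} → z ≈ z′ → ∀ n → eqSeries q z u n ≈ eqSeries q z′ u n
  eqSeries-cong q u z≈z′ n = *-congʳ (*-congˡ (pow-congˡ n z≈z′))

  module QCalculus (q : Carrier) (q≉1 : ¬ (q ≈ 1#))
                   ([n]≉0 : ∀ n → 1 ≤ n → ¬ (qint q n ≈ 0#)) where

    qfact≉0 : ∀ n → ¬ (qfact q n ≈ 0#)
    qfact≉0 zero    1≈0 = 0≉1 (sym 1≈0)
    qfact≉0 (suc n)     = x*y≉0 (qfact≉0 n) ([n]≉0 (suc n) (s≤s z≤n))

    1≈q^n+[n]*[1-q] : ∀ n → 1# ≈ pow q n + qint q n * (1# - q)
    1≈q^n+[n]*[1-q] n = begin
      1#                             ≈⟨ //-rightDividesˡ (pow q n) 1# ⟨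
      (1# - pow q n) + pow q n       ≈⟨ +-comm _ _ ⟩
      pow q n + (1# - pow q n)       ≈⟨ +-congˡ (x*y⁻¹*y≈x (1-x≉0 q≉1)) ⟨
      pow q n + qint q n * (1# - q)  ∎

    [1+n]*[1+n]!⁻¹≈[n]!⁻¹ : ∀ n → qint q (suc n) * qfact q (suc n) ⁻¹ ≈ qfact q n ⁻¹
    [1+n]*[1+n]!⁻¹≈[n]!⁻¹ n =
      inverseʳ-unique (trans (sym (*-assoc _ _ _)) (inverseʳ _ (qfact≉0 (suc n))))

    eqSeries-qdifference : ∀ y u →
      eqSeries q y u ⊖ eqSeries q (q * y) u ≋ ((1# - q) * y) ·t· eqSeries q (u * y) u
    eqSeries-qdifference y u = record { constant = refl ; step = step′ }
      where
      step′ : ∀ m → eqSeries q y u (suc m)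
                    ≈ eqSeries q (q * y) u (suc m) + ((1# - q) * y) * eqSeries q (u * y) u m
      step′ m = begin
        (Uₘ₊₁ * (y * yᵐ)) * [m+1]!⁻¹
          ≈⟨ *-identityʳ _ ⟨
        ((Uₘ₊₁ * (y * yᵐ)) * [m+1]!⁻¹) * 1#
          ≈⟨ *-cong (*-congʳ (*-congʳ (pow-[1+m]C2 u m))) (1≈q^n+[n]*[1-q] (suc m)) ⟩
        (((uᵐ * Uₘ) * (y * yᵐ)) * [m+1]!⁻¹) * (q * qᵐ + [m+1] * (1# - q))
          ≈⟨ solve 9 (λ uᵐ Uₘ y yᵐ [m+1]!⁻¹ q qᵐ [m+1] 1-q →
                          (((uᵐ :* Uₘ) :* (y :* yᵐ)) :* [m+1]!⁻¹) :* (q :* qᵐ :+ [m+1] :* 1-q)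
                       := ((uᵐ :* Uₘ) :* ((q :* y) :* (qᵐ :* yᵐ))) :* [m+1]!⁻¹
                          :+ (1-q :* y) :* ((Uₘ :* (uᵐ :* yᵐ)) :* ([m+1] :* [m+1]!⁻¹)))
                     refl uᵐ Uₘ y yᵐ [m+1]!⁻¹ q qᵐ [m+1] (1# - q) ⟩
        ((uᵐ * Uₘ) * ((q * y) * (qᵐ * yᵐ))) * [m+1]!⁻¹ + ((1# - q) * y) * ((Uₘ * (uᵐ * yᵐ)) * ([m+1] * [m+1]!⁻¹))
          ≈⟨ +-cong (*-congʳ (*-cong (sym (pow-[1+m]C2 u m)) (*-congˡ (sym (pow-distrib-* q y m)))))
                    (*-congˡ (*-cong (*-congˡ (sym (pow-distrib-* u y m))) ([1+n]*[1+n]!⁻¹≈[n]!⁻¹ m))) ⟩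
        (Uₘ₊₁ * ((q * y) * pow (q * y) m)) * [m+1]!⁻¹ + ((1# - q) * y) * ((Uₘ * pow (u * y) m) * qfact q m ⁻¹)
          ∎
        where
        Uₘ₊₁ Uₘ uᵐ yᵐ qᵐ [m+1] [m+1]!⁻¹ : Carrier
        Uₘ₊₁ = pow u (suc m C 2)
        Uₘ = pow u (m C 2)
        uᵐ = pow u m
        yᵐ = pow y m
        qᵐ = pow q m
        [m+1] = qint q (suc m)
        [m+1]!⁻¹ = qfact q (suc m) ⁻¹

    Dq-intro : ∀ f {g x} → ¬ (x ≈ 0#) → f x ≈ f (q * x) + ((1# - q) * x) * g → Dq q f x ≈ g
    Dq-intro f {g} {x} x≉0 fx≈ = begin
      (f x - f (q * x)) * ((1# - q) * x) ⁻¹     ≈⟨ *-congʳ (trans (+-congʳ fx≈) (xyx⁻¹≈y _ _)) ⟩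
      (((1# - q) * x) * g) * ((1# - q) * x) ⁻¹  ≈⟨ x*y*x⁻¹≈y (x*y≉0 (1-x≉0 q≉1) x≉0) ⟩
      g                                         ∎

    qfact-scaled-step : ∀ m {a a′ b A A′ B s} →
      A ≈ a * qfact q (suc m) → A′ ≈ a′ * qfact q (suc m) → B ≈ b * qfact q m →
      a ≈ a′ + s * b → A ≈ A′ + s * (qint q (suc m) * B)
    qfact-scaled-step m {a} {a′} {b} {A} {A′} {B} {s} A≈ A′≈ B≈ a≈ = begin
      A                                 ≈⟨ A≈ ⟩
      a * (K * I)                       ≈⟨ *-congʳ a≈ ⟩
      (a′ + s * b) * (K * I)            ≈⟨ solve 5 (λ a′ s b K I → (a′ :+ s :* b) :* (K :* I)
                                                      := a′ :* (K :* I) :+ s :* (I :* (b :* K)))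
                                                 refl a′ s b K I ⟩
      a′ * (K * I) + s * (I * (b * K))  ≈⟨ +-cong (sym A′≈) (*-congˡ (*-congˡ (sym B≈))) ⟩
      A′ + s * (I * B)                  ∎
      where
      K I : Carrier
      K = qfact q m
      I = qint q (suc m)

theorem6 : ∀ {c ℓ} (F : Field c ℓ) → let open FieldDefs F in
    (q : Carrier) → ¬ (q ≈ 1#) → (∀ n → 1 ≤ n → ¬ (qint q n ≈ 0#)) →
    (u α : Carrier) → (a : ℕ → Carrier) → ¬ (a 0 ≈ 0#) →
    (P : ℕ → Carrier → Carrier → Carrier) →
    (∀ x y n →
      ((qexpSeries q a ⊛ eqSeries q x 1#) ⊛ eqSeries q y u) n
        ≈ P n x y * (qfact q n) ⁻¹) →
    ∀ n → 1 ≤ n → ∀ x y →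
      (¬ (x ≈ 0#) →
        Dq q (λ z → P n z y) x ≈ qint q n * P (n ∸ 1) x y)
      × (¬ (y ≈ 0#) →
        Dq q (λ z → P n x z) y ≈ qint q n * P (n ∸ 1) x (u * y))
theorem6 F q q≉1 [n]≉0 u _ a _ P P-generating (suc m) (s≤s z≤n) x y = Dqˣ , Dqʸ
  where
  open FieldDefs F
  open FormalSeries F
  open QCalculus q q≉1 [n]≉0

  coeff : Carrier → Carrier → Series
  coeff x y = (qexpSeries q a ⊛ eqSeries q x 1#) ⊛ eqSeries q y u

  P≈coeff*qfact : ∀ n x y → P n x y ≈ coeff x y n * qfact q n
  P≈coeff*qfact n x y = trans (sym (x*y⁻¹*y≈x (qfact≉0 n))) (*-congʳ (sym (P-generating x y n)))

  Dqˣ : ¬ (x ≈ 0#) → Dq q (λ z → P (suc m) z y) x ≈ qint q (suc m) * P m x y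
  Dqˣ x≉0 = Dq-intro (λ z → P (suc m) z y) x≉0 (qfact-scaled-step m (P≈coeff*qfact (suc m) x y)
    (P≈coeff*qfact (suc m) (q * x) y) (P≈coeff*qfact m x y) (step coeff-qdifference m))
    where
    coeff-qdifference : coeff x y ⊖ coeff (q * x) y ≋ ((1# - q) * x) ·t· coeff x y
    coeff-qdifference = ⊛-⊖ˡ (eqSeries q y u) (⊛-⊖ʳ (qexpSeries q a)
      (·t·-cong (eqSeries-cong q 1# (*-identityˡ x)) (eqSeries-qdifference x 1#)))

  Dqʸ : ¬ (y ≈ 0#) → Dq q (λ z → P (suc m) x z) y ≈ qint q (suc m) * P m x (u * y)
  Dqʸ y≉0 = Dq-intro (λ z → P (suc m) x z) y≉0 (qfact-scaled-step m (P≈coeff*qfact (suc m) x y)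
    (P≈coeff*qfact (suc m) x (q * y)) (P≈coeff*qfact m x (u * y)) (step coeff-qdifference m))
    where
    coeff-qdifference : coeff x y ⊖ coeff x (q * y) ≋ ((1# - q) * y) ·t· coeff x (u * y)
    coeff-qdifference = ⊛-⊖ʳ (qexpSeries q a ⊛ eqSeries q x 1#) (eqSeries-qdifference y u)
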